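{- Let $\mathcal C$ be a coherent configuration and $X,Y,Z$ pairwise distinct fibers of size $4$. If $\mathcal C[X,Y]$ and $\mathcal C[X,Z]$ are both of type $C_8$, then $\mathcal C[Y,Z]$ contains a matching basis relation.
   Context: A coherent configuration on a finite set $V$ is a partition $\mathcal C$ of $V\times V$ into basis relations such that: (A) a basis relation containing a loop consists of loops; (B) the transpose of a basis relation is a basis relation; (C) for all $R,S,T\in\mathcal C$ the number $|\{w:uw\in R,wv\in S\}|$ is the same for all $uv\in T$. Fibers are sets $X$ with $\{xx:x\in X\}\in\mathcal C$; $\mathcal C[X,Y]$ is the set of basis relations contained in $X\times Y$. For 4-point fibers $X\ne Y$, $\mathcal C[X,Y]$ is of type $C_8$ if it consists of exactly two basis relations, each of which, viewed as an undirected bipartite graph on $X\cup Y$, is an 8-cycle. A basis relation $M\in\mathcal C[Y,Z]$ is a matching if each $y\in Y$ has exactly one $z$ with $yz\in M$ and each $z\in Z$ exactly one $y$ with $yz\in M$. -}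

module Defs where

open import Data.Nat using (ℕ; _+_; _%_)
open import Data.Fin using (Fin; toℕ; _≟_)
open import Data.Fin.Subset using (Subset; _∈_; _∪_; ∣_∣)
open import Data.List using (List; length; filter; allFin)
open import Data.Product using (Σ; ∃; ∃!; _×_; _,_)
open import Data.Sum using (_⊎_)
open import Function using (_⇔_)
open import Function.Definitions using (Injective)
open import Relation.Binary.PropositionalEquality using (_≡_; _≢_)
open import Relation.Nullary.Decidable using (_×-dec_)

-- A partition of V × V (V = Fin n) into r basis relations is given by a
-- colouring c : V → V → Fin r; basis relation number i is the colour class
-- { uv : c u v ≡ i }.
Colouring : ℕ → ℕ → Set
Colouring n r = Fin n → Fin n → Fin r

module _ {n r : ℕ} (c : Colouring n r) where

  Rel : Fin r → Fin n → Fin n → Set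
  Rel i u v = c u v ≡ i

  intersectionCount : Fin r → Fin r → Fin n → Fin n → ℕ
  intersectionCount i j u v =
    length (filter (λ w → (c u w ≟ i) ×-dec (c w v ≟ j)) (allFin n))

  record IsCoherentConfiguration : Set where
    field
      nonempty   : ∀ i → ∃ λ u → ∃ λ v → Rel i u v
      loops      : ∀ i u → Rel i u u → ∀ v w → Rel i v w → v ≡ w
      transpose  : ∀ i → ∃ λ j → ∀ u v → (Rel i u v ⇔ Rel j v u)
      regularity : ∀ i j k u v u′ v′ → Rel k u v → Rel k u′ v′ →
                   intersectionCount i j u v ≡ intersectionCount i j u′ v′

  IsFiber : Subset n → Set
  IsFiber X = ∃ λ i → ∀ u v → (Rel i u v ⇔ (u ≡ v × u ∈ X))

  _∈C[_,_] : Fin r → Subset n → Subset n → Set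
  i ∈C[ X , Y ] = ∀ u v → Rel i u v → u ∈ X × v ∈ Y

  IsCycle8 : Subset n → Fin r → Set
  IsCycle8 W i =
    (∀ u v → Rel i u v → u ∈ W × v ∈ W) ×
    (Σ (Fin 8 → Fin n) λ h →
       Injective _≡_ _≡_ h ×
       (∀ a → h a ∈ W) ×
       (∀ v → v ∈ W → ∃ λ a → h a ≡ v) ×
       (∀ a b → ((Rel i (h a) (h b) ⊎ Rel i (h b) (h a)) ⇔
                 (toℕ b ≡ (toℕ a + 1) % 8 ⊎ toℕ a ≡ (toℕ b + 1) % 8))))

  TypeC8 : Subset n → Subset n → Set
  TypeC8 X Y = ∃ λ i → ∃ λ j → i ≢ j ×
    (∀ k → (k ∈C[ X , Y ] ⇔ (k ≡ i ⊎ k ≡ j))) ×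
    IsCycle8 (X ∪ Y) i × IsCycle8 (X ∪ Y) j

  IsMatching : Subset n → Subset n → Fin r → Set
  IsMatching Y Z i =
    (∀ y → y ∈ Y → ∃! _≡_ λ z → Rel i y z) ×
    (∀ z → z ∈ Z → ∃! _≡_ λ y → Rel i y z)

-- Label the 8-cycle of R ∈ C[X,Y] as x₀ y₀ x₁ y₁ x₂ y₂ x₃ y₃.  Then every y ∈ Y has exactly
-- two R-neighbours, and two distinct points of X have at most one common R-neighbour.
-- Comparing the labellings of R and S produces y₀ ∈ Y and z₀ ∈ Z with two common neighbours
-- in X.  Regularity transfers this property to every pair of T = c y₀ z₀, places T inside
-- Y × Z, and (applied at the loops of Y and Z) gives every point of Y and of Z a T-partner.
-- If y had two T-partners z and z′, the two R-neighbours of y would be common S-neighbours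
-- of z and z′, forcing z ≡ z′; symmetrically for points of Z.
module Submission where

open import Defs
open import Data.Empty using (⊥; ⊥-elim)
open import Data.Fin using (Fin; toℕ; fromℕ<; _≟_)
open import Data.Fin.Patterns using (0F; 1F; 2F; 3F)
open import Data.Fin.Properties using (all?; any?)
open import Data.Fin.Subset using (Subset; _∈_; _⊆_; _∪_; ∣_∣)
open import Data.Fin.Subset.Properties using (⊆-antisym; x∈p∪q⁺; x∈p∪q⁻)
open import Data.List using ([]; _∷_; length; filter; allFin)
open import Data.List.Membership.Propositional using () renaming (_∈_ to _∈ₗ_)
open import Data.List.Membership.Propositional.Properties using (∈-filter⁺; ∈-allFin; ∈-length)
open import Data.List.Relation.Unary.All using (All; _∷_)
open import Data.List.Relation.Unary.All.Properties using (all-filter)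
open import Data.List.Relation.Unary.AllPairs using (_∷_)
open import Data.List.Relation.Unary.Any using (here; there)
open import Data.List.Relation.Unary.Unique.Propositional using (Unique)
import Data.List.Relation.Unary.Unique.Propositional.Properties as Unique
open import Data.Nat as ℕ using (ℕ; suc; _+_; _*_; _%_; _<_; s<s)
open import Data.Nat.DivMod using (m%n<n)
open import Data.Nat.Properties using (m<n⇒m<1+n)
open import Data.Product using (∃; ∃₂; ∃!; _×_; _,_; proj₁; proj₂)
open import Data.Sum as Sum using (_⊎_; inj₁; inj₂; swap)
open import Function using (_∘_; _⇔_; Equivalence)
open import Function.Definitions using (Injective)
open import Relation.Binary.PropositionalEquality using (_≡_; _≢_; refl; cong; sym; trans; subst)
open import Relation.Nullary using (Dec; ¬?)
open import Relation.Nullary.Decidable using (from-yes; _→-dec_; _×-dec_; _⊎-dec_)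
import Relation.Unary as U

module _ {n : ℕ} {P : Fin n → Set} (P? : U.Decidable P) where

  ∃⇒0<count : ∃ P → 0 < length (filter P? (allFin n))
  ∃⇒0<count (w , Pw) = ∈-length (∈-filter⁺ P? (∈-allFin w) Pw)

  0<count⇒∃ : 0 < length (filter P? (allFin n)) → ∃ P
  0<count⇒∃ = head-witness (all-filter P? (allFin n))
    where
    head-witness : ∀ {ws} → All P ws → 0 < length ws → ∃ P
    head-witness {w ∷ _} (Pw ∷ _) _ = w , Pw

  two⇒1<count : ∀ {w w′} → w ≢ w′ → P w → P w′ → 1 < length (filter P? (allFin n))
  two⇒1<count {w} {w′} w≢w′ Pw Pw′ =
    distinct-∈⇒1<length (∈-filter⁺ P? (∈-allFin w) Pw) (∈-filter⁺ P? (∈-allFin w′) Pw′) w≢w′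
    where
    distinct-∈⇒1<length : ∀ {x x′ : Fin n} {ws} → x ∈ₗ ws → x′ ∈ₗ ws → x ≢ x′ → 1 < length ws
    distinct-∈⇒1<length (here refl) (here refl) x≢x′ = ⊥-elim (x≢x′ refl)
    distinct-∈⇒1<length (here refl) (there x′∈) _    = s<s (∈-length x′∈)
    distinct-∈⇒1<length (there x∈) (here refl) _     = s<s (∈-length x∈)
    distinct-∈⇒1<length (there x∈) (there x′∈) x≢x′  = m<n⇒m<1+n (distinct-∈⇒1<length x∈ x′∈ x≢x′)

  1<count⇒two : 1 < length (filter P? (allFin n)) → ∃₂ λ w w′ → w ≢ w′ × P w × P w′
  1<count⇒two = first-two (all-filter P? (allFin n)) (Unique.filter⁺ P? (Unique.allFin⁺ n))
    where
    first-two : ∀ {ws} → All P ws → Unique ws → 1 < length ws → ∃₂ λ w w′ → w ≢ w′ × P w × P w′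
    first-two {_ ∷ []} _ _ (s<s ())
    first-two {w ∷ w′ ∷ _} (Pw ∷ Pw′ ∷ _) ((w≢w′ ∷ _) ∷ _) _ = w , w′ , w≢w′ , Pw , Pw′

module _ {n r : ℕ} (c : Colouring n r) where

  Path : Fin r → Fin r → Fin n → Fin n → Fin n → Set
  Path i j u v w = Rel c i u w × Rel c j w v

  path? : ∀ i j u v → U.Decidable (Path i j u v)
  path? i j u v w = (c u w ≟ i) ×-dec (c w v ≟ j)

module _ {n r : ℕ} {c : Colouring n r} (cc : IsCoherentConfiguration c) where
  open IsCoherentConfiguration cc

  count-transfer : ∀ {i j u v u′ v′} → Rel c (c u v) u′ v′ →
                   intersectionCount c i j u v ≡ intersectionCount c i j u′ v′
  count-transfer {i} {j} {u} {v} = regularity i j (c u v) u v _ _ refl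

  path-transfer : ∀ {i j u v u′ v′} → Rel c (c u v) u′ v′ → ∃ (Path c i j u v) → ∃ (Path c i j u′ v′)
  path-transfer {i} {j} {u} {v} {u′} {v′} uv∼u′v′ path =
    0<count⇒∃ (path? c i j u′ v′)
      (subst (0 <_) (count-transfer uv∼u′v′) (∃⇒0<count (path? c i j u v) path))

  two-paths-transfer : ∀ {i j u v u′ v′ w w′} → Rel c (c u v) u′ v′ → w ≢ w′ →
                       Path c i j u v w → Path c i j u v w′ →
                       ∃₂ λ t t′ → t ≢ t′ × Path c i j u′ v′ t × Path c i j u′ v′ t′
  two-paths-transfer {i} {j} {u} {v} {u′} {v′} uv∼u′v′ w≢w′ path path′ =
    1<count⇒two (path? c i j u′ v′)
      (subst (1 <_) (count-transfer uv∼u′v′) (two⇒1<count (path? c i j u v) w≢w′ path path′))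

module _ {n r : ℕ} {c : Colouring n r} where

  fibre-loop : ∀ {X} (fX : IsFiber c X) → ∀ {u} → u ∈ X → Rel c (proj₁ fX) u u
  fibre-loop fX u∈X = Equivalence.from (proj₂ fX _ _) (refl , u∈X)

  fibre-members : ∀ {X} (fX : IsFiber c X) → ∀ {u v} → Rel c (proj₁ fX) u v → u ∈ X × v ∈ X
  fibre-members fX {u} {v} uv∈loop with Equivalence.to (proj₂ fX u v) uv∈loop
  ... | refl , u∈X = u∈X , u∈X

  fibre-loops-coincide : ∀ {X} → IsFiber c X → ∀ {u v} → u ∈ X → v ∈ X → Rel c (c u u) v v
  fibre-loops-coincide fX u∈X v∈X = trans (fibre-loop fX v∈X) (sym (fibre-loop fX u∈X))

  fibre-⊆ : ∀ {X Y u} → IsFiber c X → IsFiber c Y → u ∈ X → u ∈ Y → X ⊆ Y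
  fibre-⊆ fX fY u∈X u∈Y v∈X =
    proj₁ (fibre-members fY (trans (fibre-loops-coincide fX u∈X v∈X) (fibre-loop fY u∈Y)))

fibres-disjoint : ∀ {n r} {c : Colouring n r} {X Y : Subset n} → IsFiber c X → IsFiber c Y →
                  X ≢ Y → ∀ {u} → u ∈ X → u ∈ Y → ⊥
fibres-disjoint fX fY X≢Y u∈X u∈Y = X≢Y (⊆-antisym (fibre-⊆ fX fY u∈X u∈Y) (fibre-⊆ fY fX u∈Y u∈X))

colour-between-fibres : ∀ {n r} {c : Colouring n r} {Y Z : Subset n} {y z} →
                        IsCoherentConfiguration c → IsFiber c Y → IsFiber c Z →
                        y ∈ Y → z ∈ Z → _∈C[_,_] c (c y z) Y Z
colour-between-fibres {c = c} {Y} {Z} {y} {z} cc fY fZ y∈Y z∈Z u v uv∈T =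
  tail-in-Y (path-transfer cc uv∈T (y , fibre-loop fY y∈Y , refl)) ,
  head-in-Z (path-transfer cc uv∈T (z , refl , fibre-loop fZ z∈Z))
  where
  tail-in-Y : ∃ (Path c (proj₁ fY) (c y z) u v) → u ∈ Y
  tail-in-Y (_ , uw∈loop , _) = proj₁ (fibre-members fY uw∈loop)
  head-in-Z : ∃ (Path c (c y z) (proj₁ fZ) u v) → v ∈ Z
  head-in-Z (_ , _ , wv∈loop) = proj₂ (fibre-members fZ wv∈loop)

next : Fin 4 → Fin 4
next 0F = 1F
next 1F = 2F
next 2F = 3F
next 3F = 0F

-- Reading an 8-cycle between X and Y as x₀ y₀ x₁ y₁ x₂ y₂ x₃ y₃, the point xₖ is adjacent
-- to yₗ iff k is l or l + 1 (mod 4).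
Adjacent : Fin 4 → Fin 4 → Set
Adjacent k l = k ≡ l ⊎ k ≡ next l

adjacent? : ∀ k l → Dec (Adjacent k l)
adjacent? k l = (k ≟ l) ⊎-dec (k ≟ next l)

adjacent-at-most-two : ∀ l k₁ k₂ k → k₁ ≢ k₂ →
  Adjacent k₁ l → Adjacent k₂ l → Adjacent k l → k ≡ k₁ ⊎ k ≡ k₂
adjacent-at-most-two = from-yes (all? λ l → all? λ k₁ → all? λ k₂ → all? λ k →
  ¬? (k₁ ≟ k₂) →-dec adjacent? k₁ l →-dec adjacent? k₂ l →-dec adjacent? k l →-dec
  ((k ≟ k₁) ⊎-dec (k ≟ k₂)))

adjacent-common-unique : ∀ k₁ k₂ l l′ → k₁ ≢ k₂ →
  Adjacent k₁ l → Adjacent k₂ l → Adjacent k₁ l′ → Adjacent k₂ l′ → l ≡ l′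
adjacent-common-unique = from-yes (all? λ k₁ → all? λ k₂ → all? λ l → all? λ l′ →
  ¬? (k₁ ≟ k₂) →-dec adjacent? k₁ l →-dec adjacent? k₂ l →-dec adjacent? k₁ l′ →-dec
  adjacent? k₂ l′ →-dec l ≟ l′)

adjacent-to-one-of : ∀ k k₁ k₂ → k₁ ≢ k₂ → k₁ ≢ k → k₂ ≢ k →
  (∃ λ l → Adjacent k l × Adjacent k₁ l) ⊎ (∃ λ l → Adjacent k l × Adjacent k₂ l)
adjacent-to-one-of = from-yes (all? λ k → all? λ k₁ → all? λ k₂ →
  ¬? (k₁ ≟ k₂) →-dec ¬? (k₁ ≟ k) →-dec ¬? (k₂ ≟ k) →-dec
  (any? (λ l → adjacent? k l ×-dec adjacent? k₁ l) ⊎-dec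
   any? (λ l → adjacent? k l ×-dec adjacent? k₂ l)))

Adjacent₈ : Fin 8 → Fin 8 → Set
Adjacent₈ a b = toℕ b ≡ (toℕ a + 1) % 8 ⊎ toℕ a ≡ (toℕ b + 1) % 8

adjacent₈? : ∀ a b → Dec (Adjacent₈ a b)
adjacent₈? a b = (toℕ b ℕ.≟ (toℕ a + 1) % 8) ⊎-dec (toℕ a ℕ.≟ (toℕ b + 1) % 8)

_⊕_ : Fin 8 → ℕ → Fin 8
a ⊕ m = fromℕ< (m%n<n (toℕ a + m) 8)

-- Positions of xₖ and yₗ on an 8-cycle on which x₀ sits at position p.
xPos yPos : Fin 8 → Fin 4 → Fin 8
xPos p k = p ⊕ (2 * toℕ k)
yPos p l = p ⊕ suc (2 * toℕ l)

adjacent⇒adjacent₈ : ∀ p k l → Adjacent k l → Adjacent₈ (xPos p k) (yPos p l)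
adjacent⇒adjacent₈ = from-yes (all? λ p → all? λ k → all? λ l →
  adjacent? k l →-dec adjacent₈? (xPos p k) (yPos p l))

adjacent₈⇒adjacent : ∀ p k l → Adjacent₈ (xPos p k) (yPos p l) → Adjacent k l
adjacent₈⇒adjacent = from-yes (all? λ p → all? λ k → all? λ l →
  adjacent₈? (xPos p k) (yPos p l) →-dec adjacent? k l)

xPos-or-yPos : ∀ p a → (∃ λ k → a ≡ xPos p k) ⊎ (∃ λ l → a ≡ yPos p l)
xPos-or-yPos = from-yes (all? λ p → all? λ a →
  (any? (λ k → a ≟ xPos p k) ⊎-dec any? (λ l → a ≟ yPos p l)))

xPos-injective : ∀ p k k′ → xPos p k ≡ xPos p k′ → k ≡ k′
xPos-injective = from-yes (all? λ p → all? λ k → all? λ k′ → (xPos p k ≟ xPos p k′) →-dec k ≟ k′)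

yPos-injective : ∀ p l l′ → yPos p l ≡ yPos p l′ → l ≡ l′
yPos-injective = from-yes (all? λ p → all? λ l → all? λ l′ → (yPos p l ≟ yPos p l′) →-dec l ≟ l′)

record C8Labelling {n r : ℕ} (c : Colouring n r) (X Y : Subset n) (R : Fin r) : Set where
  field
    xs ys        : Fin 4 → Fin n
    xs∈X         : ∀ k → xs k ∈ X
    ys∈Y         : ∀ l → ys l ∈ Y
    xs-onto      : ∀ {u} → u ∈ X → ∃ λ k → u ≡ xs k
    xs-injective : Injective _≡_ _≡_ xs
    ys-injective : Injective _≡_ _≡_ ys
    edge         : ∀ {k l} → Adjacent k l → Rel c R (xs k) (ys l)
    edge⁻        : ∀ {u v} → Rel c R u v → ∃₂ λ k l → u ≡ xs k × v ≡ ys l × Adjacent k l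

  related⇒∈Y : ∀ {u v} → Rel c R u v → v ∈ Y
  related⇒∈Y Ruv with edge⁻ Ruv
  ... | _ , l , _ , refl , _ = ys∈Y l

  neighbours-at-most-two : ∀ {a b u y} → a ≢ b →
                           Rel c R a y → Rel c R b y → Rel c R u y → u ≡ a ⊎ u ≡ b
  neighbours-at-most-two a≢b Ray Rby Ruy with edge⁻ Ray | edge⁻ Rby | edge⁻ Ruy
  ... | ka , l , refl , refl , ka∼l | kb , lb , refl , l≡lb , kb∼lb | k , lu , refl , l≡lu , k∼lu
    with ys-injective l≡lb | ys-injective l≡lu
  ... | refl | refl =
    Sum.map (cong xs) (cong xs) (adjacent-at-most-two l ka kb k (a≢b ∘ cong xs) ka∼l kb∼lb k∼lu)

  common-neighbour-unique : ∀ {a b y y′} → a ≢ b →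
                            Rel c R a y → Rel c R b y → Rel c R a y′ → Rel c R b y′ → y ≡ y′
  common-neighbour-unique a≢b Ray Rby Ray′ Rby′ with edge⁻ Ray | edge⁻ Rby | edge⁻ Ray′ | edge⁻ Rby′
  ... | ka , l , refl , refl , ka∼l | kb , lb , refl , l≡lb , kb∼lb
      | ka′ , l′ , ka≡ka′ , refl , ka′∼l′ | kb′ , lb′ , kb≡kb′ , l′≡lb′ , kb′∼lb′
    with ys-injective l≡lb | ys-injective l′≡lb′ | xs-injective ka≡ka′ | xs-injective kb≡kb′
  ... | refl | refl | refl | refl =
    cong ys (adjacent-common-unique ka kb l l′ (a≢b ∘ cong xs) ka∼l kb∼lb ka′∼l′ kb′∼lb′)

module LabellingOfCycle8 {n r : ℕ} {c : Colouring n r} {X Y : Subset n} {R : Fin r}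
  (X∩Y≡∅ : ∀ {u} → u ∈ X → u ∈ Y → ⊥) (R∈C[X,Y] : _∈C[_,_] c R X Y)
  (h : Fin 8 → Fin n) (h-injective : Injective _≡_ _≡_ h)
  (h∈X∪Y : ∀ a → h a ∈ X ∪ Y) (h-onto : ∀ u → u ∈ X ∪ Y → ∃ λ a → h a ≡ u)
  (h-adjacent : ∀ a b → (Rel c R (h a) (h b) ⊎ Rel c R (h b) (h a)) ⇔ Adjacent₈ a b) where

  step-from-X : ∀ {a b} → h a ∈ X → Adjacent₈ a b → Rel c R (h a) (h b)
  step-from-X {a} {b} ha∈X a∼b with Equivalence.from (h-adjacent a b) a∼b
  ... | inj₁ Rab = Rab
  ... | inj₂ Rba = ⊥-elim (X∩Y≡∅ ha∈X (proj₂ (R∈C[X,Y] _ _ Rba)))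

  step-from-Y : ∀ {a b} → h a ∈ Y → Adjacent₈ a b → Rel c R (h b) (h a)
  step-from-Y {a} {b} ha∈Y a∼b with Equivalence.from (h-adjacent a b) a∼b
  ... | inj₁ Rab = ⊥-elim (X∩Y≡∅ (proj₁ (R∈C[X,Y] _ _ Rab)) ha∈Y)
  ... | inj₂ Rba = Rba

  start : ∃ λ p → h (xPos p 0F) ∈ X
  start with x∈p∪q⁻ X Y (h∈X∪Y 0F)
  ... | inj₁ h0∈X = 0F , h0∈X
  ... | inj₂ h0∈Y = 1F , proj₁ (R∈C[X,Y] _ _ (step-from-Y h0∈Y (inj₁ refl)))

  p : Fin 8
  p = proj₁ start

  xs ys : Fin 4 → Fin n
  xs k = h (xPos p k)
  ys l = h (yPos p l)

  ys∈Y-of : ∀ k → xs k ∈ X → ys k ∈ Y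
  ys∈Y-of k xk∈X = proj₂ (R∈C[X,Y] _ _ (step-from-X xk∈X (adjacent⇒adjacent₈ p k k (inj₁ refl))))

  xs-next∈X : ∀ k → xs k ∈ X → xs (next k) ∈ X
  xs-next∈X k xk∈X =
    proj₁ (R∈C[X,Y] _ _ (step-from-Y (ys∈Y-of k xk∈X) (swap (adjacent⇒adjacent₈ p (next k) k (inj₂ refl)))))

  xs∈X : ∀ k → xs k ∈ X
  xs∈X 0F = proj₂ start
  xs∈X 1F = xs-next∈X 0F (proj₂ start)
  xs∈X 2F = xs-next∈X 1F (xs-next∈X 0F (proj₂ start))
  xs∈X 3F = xs-next∈X 2F (xs-next∈X 1F (xs-next∈X 0F (proj₂ start)))

  ys∈Y : ∀ l → ys l ∈ Y
  ys∈Y l = ys∈Y-of l (xs∈X l)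

  xs-onto : ∀ {u} → u ∈ X → ∃ λ k → u ≡ xs k
  xs-onto u∈X with h-onto _ (x∈p∪q⁺ (inj₁ u∈X))
  ... | a , refl with xPos-or-yPos p a
  ...   | inj₁ (k , refl) = k , refl
  ...   | inj₂ (l , refl) = ⊥-elim (X∩Y≡∅ u∈X (ys∈Y l))

  ys-onto : ∀ {v} → v ∈ Y → ∃ λ l → v ≡ ys l
  ys-onto v∈Y with h-onto _ (x∈p∪q⁺ (inj₂ v∈Y))
  ... | a , refl with xPos-or-yPos p a
  ...   | inj₁ (k , refl) = ⊥-elim (X∩Y≡∅ (xs∈X k) v∈Y)
  ...   | inj₂ (l , refl) = l , refl

  edge⁻ : ∀ {u v} → Rel c R u v → ∃₂ λ k l → u ≡ xs k × v ≡ ys l × Adjacent k l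
  edge⁻ {u} {v} Ruv with xs-onto (proj₁ (R∈C[X,Y] u v Ruv)) | ys-onto (proj₂ (R∈C[X,Y] u v Ruv))
  ... | k , refl | l , refl =
    k , l , refl , refl , adjacent₈⇒adjacent p k l (Equivalence.to (h-adjacent _ _) (inj₁ Ruv))

  labelling : C8Labelling c X Y R
  labelling = record
    { xs           = xs
    ; ys           = ys
    ; xs∈X         = xs∈X
    ; ys∈Y         = ys∈Y
    ; xs-onto      = xs-onto
    ; xs-injective = λ e → xPos-injective p _ _ (h-injective e)
    ; ys-injective = λ e → yPos-injective p _ _ (h-injective e)
    ; edge         = λ {k} {l} k∼l → step-from-X (xs∈X k) (adjacent⇒adjacent₈ p k l k∼l)
    ; edge⁻        = edge⁻
    }

cycle8⇒labelling : ∀ {n r} {c : Colouring n r} {X Y : Subset n} {R : Fin r} →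
                   (∀ {u} → u ∈ X → u ∈ Y → ⊥) → _∈C[_,_] c R X Y →
                   IsCycle8 c (X ∪ Y) R → C8Labelling c X Y R
cycle8⇒labelling X∩Y≡∅ R∈C[X,Y] (_ , h , h-injective , h∈X∪Y , h-onto , h-adjacent) =
  LabellingOfCycle8.labelling X∩Y≡∅ R∈C[X,Y] h h-injective h∈X∪Y h-onto h-adjacent

CommonNeighbours : ∀ {n r} → Colouring n r → Fin r → Fin r → Fin n → Fin n → Set
CommonNeighbours c R S y z =
  ∃₂ λ x x′ → x ≢ x′ × Rel c R x y × Rel c R x′ y × Rel c S x z × Rel c S x′ z

module _ {n r : ℕ} {c : Colouring n r} where

  CommonNeighbours-swap : ∀ {R S y z} → CommonNeighbours c R S y z → CommonNeighbours c S R z y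
  CommonNeighbours-swap (x , x′ , x≢x′ , Rxy , Rx′y , Sxz , Sx′z) =
    x , x′ , x≢x′ , Sxz , Sx′z , Rxy , Rx′y

  common-neighbours-transfer : ∀ {R S y z y′ z′} → IsCoherentConfiguration c → Rel c (c y z) y′ z′ →
                               CommonNeighbours c R S y z → CommonNeighbours c R S y′ z′
  common-neighbours-transfer {R} {S} {y′ = y′} {z′} cc yz∼y′z′
                             (x , x′ , x≢x′ , Rxy , Rx′y , Sxz , Sx′z) =
    from-paths (two-paths-transfer cc yz∼y′z′ x≢x′ (toᵗ Rxy , Sxz) (toᵗ Rx′y , Sx′z))
    where
    open IsCoherentConfiguration cc using (transpose)
    Rᵗ = proj₁ (transpose R)
    toᵗ : ∀ {u v} → Rel c R u v → Rel c Rᵗ v u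
    toᵗ = Equivalence.to (proj₂ (transpose R) _ _)
    fromᵗ : ∀ {u v} → Rel c Rᵗ v u → Rel c R u v
    fromᵗ = Equivalence.from (proj₂ (transpose R) _ _)
    from-paths : (∃₂ λ t t′ → t ≢ t′ × Path c Rᵗ S y′ z′ t × Path c Rᵗ S y′ z′ t′) →
                 CommonNeighbours c R S y′ z′
    from-paths (t , t′ , t≢t′ , (y′t , tz′) , (y′t′ , t′z′)) =
      t , t′ , t≢t′ , fromᵗ y′t , fromᵗ y′t′ , tz′ , t′z′

  module _ {X Y Z : Subset n} {R S : Fin r} (LR : C8Labelling c X Y R) (LS : C8Labelling c X Z S) where
    private
      module ℛ = C8Labelling LR
      module 𝒮 = C8Labelling LS

    -- In S the vertex x₀ shares a neighbour with x₁ and with x₃, while in R every vertex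
    -- shares a neighbour with all but one of the other three.
    common-neighbours-exist : ∃₂ (CommonNeighbours c R S)
    common-neighbours-exist =
      Sum.[ shared 1F 0F (λ ()) (inj₁ refl) (inj₂ refl) , shared 3F 3F (λ ()) (inj₂ refl) (inj₁ refl) ]
        (adjacent-to-one-of (m 0F) (m 1F) (m 3F) (m-distinct λ ()) (m-distinct λ ()) (m-distinct λ ()))
      where
      m : Fin 4 → Fin 4
      m i = proj₁ (ℛ.xs-onto (𝒮.xs∈X i))
      m-spec : ∀ i → 𝒮.xs i ≡ ℛ.xs (m i)
      m-spec i = proj₂ (ℛ.xs-onto (𝒮.xs∈X i))
      m-distinct : ∀ {i j} → i ≢ j → m i ≢ m j
      m-distinct i≢j mi≡mj =
        i≢j (𝒮.xs-injective (trans (m-spec _) (trans (cong ℛ.xs mi≡mj) (sym (m-spec _)))))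
      R-edge : ∀ i {l} → Adjacent (m i) l → Rel c R (𝒮.xs i) (ℛ.ys l)
      R-edge i m∼l = subst (λ u → Rel c R u _) (sym (m-spec i)) (ℛ.edge m∼l)
      shared : ∀ i l → 0F ≢ i → Adjacent 0F l → Adjacent i l →
               (∃ λ l′ → Adjacent (m 0F) l′ × Adjacent (m i) l′) → ∃₂ (CommonNeighbours c R S)
      shared i l 0≢i 0∼l i∼l (l′ , m0∼l′ , mi∼l′) =
        ℛ.ys l′ , 𝒮.ys l , 𝒮.xs 0F , 𝒮.xs i , (0≢i ∘ 𝒮.xs-injective) ,
        R-edge 0F m0∼l′ , R-edge i mi∼l′ , 𝒮.edge 0∼l , 𝒮.edge i∼l

    -- The two R-neighbours of y are common S-neighbours of w and of z.
    common-neighbours-determine : ∀ {y w z} →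
                                  CommonNeighbours c R S y w → CommonNeighbours c R S y z → w ≡ z
    common-neighbours-determine {y} {w} {z} (a , a′ , a≢a′ , Ray , Ra′y , Saw , Sa′w)
                                            (b , b′ , b≢b′ , Rby , Rb′y , Sbz , Sb′z) =
      𝒮.common-neighbour-unique a≢a′ Saw Sa′w (S-to-z Ray) (S-to-z Ra′y)
      where
      S-to-z : ∀ {u} → Rel c R u y → Rel c S u z
      S-to-z Ruy =
        Sum.[ (λ { refl → Sbz }) , (λ { refl → Sb′z }) ] (ℛ.neighbours-at-most-two b≢b′ Rby Rb′y Ruy)

C8-pair⇒matching : ∀ {n r} {c : Colouring n r} {X Y Z : Subset n} {R S : Fin r} →
                   IsCoherentConfiguration c → IsFiber c Y → IsFiber c Z →
                   C8Labelling c X Y R → C8Labelling c X Z S →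
                   ∃ λ T → _∈C[_,_] c T Y Z × IsMatching c Y Z T
C8-pair⇒matching {c = c} {Y = Y} {Z} {R} {S} cc fY fZ LR LS with common-neighbours-exist LR LS
... | y₀ , z₀ , common₀@(_ , _ , _ , Rxy₀ , _ , Sxz₀ , _) =
  c y₀ z₀ , colour-between-fibres cc fY fZ y₀∈Y z₀∈Z , partner-of-Y , partner-of-Z
  where
  y₀∈Y = C8Labelling.related⇒∈Y LR Rxy₀
  z₀∈Z = C8Labelling.related⇒∈Y LS Sxz₀

  common : ∀ {u v} → Rel c (c y₀ z₀) u v → CommonNeighbours c R S u v
  common uv∈T = common-neighbours-transfer cc uv∈T common₀

  common-swapped : ∀ {u v} → Rel c (c y₀ z₀) u v → CommonNeighbours c S R v u
  common-swapped uv∈T = CommonNeighbours-swap {c = c} (common uv∈T)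

  partner-of-Y : ∀ y → y ∈ Y → ∃! _≡_ λ z → Rel c (c y₀ z₀) y z
  partner-of-Y y y∈Y with path-transfer cc (fibre-loops-coincide fY y₀∈Y y∈Y) (z₀ , refl , refl)
  ... | z , yz∈T , _ = z , yz∈T , λ yz′∈T →
    common-neighbours-determine LR LS (common yz∈T) (common yz′∈T)

  partner-of-Z : ∀ z → z ∈ Z → ∃! _≡_ λ y → Rel c (c y₀ z₀) y z
  partner-of-Z z z∈Z with path-transfer cc (fibre-loops-coincide fZ z₀∈Z z∈Z) (y₀ , refl , refl)
  ... | y , _ , yz∈T = y , yz∈T , λ y′z∈T →
    common-neighbours-determine LS LR (common-swapped yz∈T) (common-swapped y′z∈T)

lemma6p2 : (n r : ℕ) (c : Colouring n r) → IsCoherentConfiguration c →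
    (X Y Z : Subset n) → IsFiber c X → IsFiber c Y → IsFiber c Z →
    X ≢ Y → X ≢ Z → Y ≢ Z →
    ∣ X ∣ ≡ 4 → ∣ Y ∣ ≡ 4 → ∣ Z ∣ ≡ 4 →
    TypeC8 c X Y → TypeC8 c X Z →
    ∃ λ i → (_∈C[_,_] c i Y Z) × IsMatching c Y Z i
lemma6p2 n r c cc X Y Z fX fY fZ X≢Y X≢Z _ _ _ _
         (R , _ , _ , C[X,Y]≡R,R′ , R-cycle , _) (S , _ , _ , C[X,Z]≡S,S′ , S-cycle , _) =
  C8-pair⇒matching cc fY fZ
    (cycle8⇒labelling (fibres-disjoint fX fY X≢Y) (Equivalence.from (C[X,Y]≡R,R′ R) (inj₁ refl)) R-cycle)
    (cycle8⇒labelling (fibres-disjoint fX fZ X≢Z) (Equivalence.from (C[X,Z]≡S,S′ S) (inj₁ refl)) S-cycle)
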